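{- Consider any bad 2-colouring of the edges of $Q_3$ with colours red and blue, and any vertex $v$ of $Q_3$, and let $v'$ be the vertex antipodal to $v$. Then there exists an antipodal geodesic from $v$ to $v'$ with exactly one colour change, whose edge at $v$ is red and whose edge at $v'$ is blue.
   Context: $Q_3$ has vertex set $\{0,1\}^3$, two vertices adjacent if they differ in exactly one coordinate (the direction of the edge). Two vertices are antipodal if their distance is $3$. A geodesic is a path with no two edges of the same direction; an antipodal geodesic is a geodesic joining two antipodal vertices (so it has length 3). The number of colour changes of a path $(u_0,\dots,u_m)$ is the number of $i\in\{1,\dots,m-1\}$ such that the edges $u_{i-1}u_i$ and $u_iu_{i+1}$ have different colours. A 2-colouring of the edges of $Q_3$ is called good if there exist 4 antipodal geodesics such that each vertex of $Q_3$ is an endpoint of exactly one of them and the total number of colour changes of these 4 geodesics is at most two; otherwise it is called bad. -}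

module Defs where

open import Data.Bool using (Bool; true; false; not)
open import Data.Fin using (Fin)
open import Data.Nat using (ℕ; zero; suc; _+_; _≤_)
open import Data.Vec using (Vec; map; _[_]%=_; _[_]≔_)
open import Data.Product using (Σ; _×_; _,_)
open import Data.Sum using (_⊎_)
open import Relation.Binary.PropositionalEquality using (_≡_; _≢_)
open import Relation.Nullary using (¬_)

Vertex : Set
Vertex = Vec Bool 3

Dir : Set
Dir = Fin 3

flip : Vertex → Dir → Vertex
flip v i = v [ i ]%= not

antipode : Vertex → Vertex
antipode v = map not v

data Colour : Set where
  red blue : Colour

-- The edge of direction i between v and flip v i
-- is identified by (i, its endpoint with i-th coordinate false);
-- a colouring assigns a colour to each such pair (entries whose vertex has
-- i-th coordinate true are irrelevant: they are never read).
Colouring : Set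
Colouring = Dir → Vertex → Colour

edgeColour : Colouring → Vertex → Dir → Colour
edgeColour κ v i = κ i (v [ i ]≔ false)

record AGeodesic : Set where
  constructor geo
  field
    start : Vertex
    d₀ d₁ d₂ : Dir
    d₀≢d₁ : d₀ ≢ d₁
    d₀≢d₂ : d₀ ≢ d₂
    d₁≢d₂ : d₁ ≢ d₂
open AGeodesic public

u₀ u₁ u₂ u₃ : AGeodesic → Vertex
u₀ g = start g
u₁ g = flip (u₀ g) (d₀ g)
u₂ g = flip (u₁ g) (d₁ g)
u₃ g = flip (u₂ g) (d₂ g)

c₀ c₁ c₂ : Colouring → AGeodesic → Colour
c₀ κ g = edgeColour κ (u₀ g) (d₀ g)
c₁ κ g = edgeColour κ (u₁ g) (d₁ g)
c₂ κ g = edgeColour κ (u₂ g) (d₂ g)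

diff : Colour → Colour → ℕ
diff red red = 0
diff blue blue = 0
diff red blue = 1
diff blue red = 1

changes : Colouring → AGeodesic → ℕ
changes κ g = diff (c₀ κ g) (c₁ κ g) + diff (c₁ κ g) (c₂ κ g)

IsEndpoint : Vertex → AGeodesic → Set
IsEndpoint v g = (v ≡ u₀ g) ⊎ (v ≡ u₃ g)

Good : Colouring → Set
Good κ = Σ (Fin 4 → AGeodesic) λ gs →
  ((v : Vertex) → Σ (Fin 4) λ j → IsEndpoint v (gs j) ×
      ((k : Fin 4) → IsEndpoint v (gs k) → k ≡ j))
  × (changes κ (gs Fin.zero) + changes κ (gs (Fin.suc Fin.zero))
     + changes κ (gs (Fin.suc (Fin.suc Fin.zero)))
     + changes κ (gs (Fin.suc (Fin.suc (Fin.suc Fin.zero))))) ≤ 2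

Bad : Colouring → Set
Bad κ = ¬ Good κ

-- If some edge at v is red and an edge at v′ of another direction is blue, the antipodal
-- geodesic that leaves v along the first and enters v′ along the second is coloured
-- red, ?, blue, so it changes colour exactly once. It remains to see that a colouring
-- failing this condition at some vertex is good. A colouring is determined by its 12 edge
-- colours, and for each of the 2¹² of them either the condition holds at every vertex or
-- choosing, for each antipodal pair, a geodesic with fewest colour changes gives a total
-- of at most two.
module Submission where

open import Defs
open import Data.Bool using (Bool; true; false)
open import Data.Empty using (⊥-elim)
open import Data.Fin using (Fin; zero; suc)
import Data.Fin.Properties as Fin
open import Data.Nat as ℕ using (ℕ; _+_; _≤_; _≤?_)
open import Data.Nat.Properties using (≤-totalOrder)
open import Data.List.Extrema ≤-totalOrder using (argmin)
open import Data.Product using (Σ; ∃₂; _×_; _,_)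
open import Data.Sum using (_⊎_; inj₁; inj₂; [_,_]′)
open import Data.Vec using (Vec; []; _∷_; lookup; tabulate; toList; _[_]≔_)
open import Data.Vec.Properties using (updateAt-updateAt; lookup∘tabulate)
open import Function using (_∘_)
open import Relation.Binary.Definitions using (DecidableEquality)
open import Relation.Binary.PropositionalEquality
  using (_≡_; _≢_; refl; sym; trans; cong; cong₂; subst; module ≡-Reasoning)
open import Relation.Nullary using (Dec; yes; no; ¬?)
open import Relation.Nullary.Decidable using (map′; _×-dec_; _⊎-dec_; toWitness)
open import Relation.Unary using (Decidable)

infix 4 _≟ᶜ_

_≟ᶜ_ : DecidableEquality Colour
red  ≟ᶜ red  = yes refl
red  ≟ᶜ blue = no λ ()
blue ≟ᶜ red  = no λ ()
blue ≟ᶜ blue = yes refl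

diff-red-blue : ∀ c → diff red c + diff c blue ≡ 1
diff-red-blue red  = refl
diff-red-blue blue = refl

edgeColour-flip : ∀ κ v i → edgeColour κ (flip v i) i ≡ edgeColour κ v i
edgeColour-flip κ v i = cong (κ i) (updateAt-updateAt i v)

DistinctDirs : Set
DistinctDirs = Σ (Dir × Dir) λ (i , k) → i ≢ k

thirdDir : ((i , k) : Dir × Dir) → i ≢ k → Σ Dir λ j → i ≢ j × j ≢ k
thirdDir (zero , suc zero) _ = suc (suc zero) , (λ ()) , (λ ())
thirdDir (zero , suc (suc zero)) _ = suc zero , (λ ()) , (λ ())
thirdDir (suc zero , zero) _ = suc (suc zero) , (λ ()) , (λ ())
thirdDir (suc zero , suc (suc zero)) _ = zero , (λ ()) , (λ ())
thirdDir (suc (suc zero) , zero) _ = suc zero , (λ ()) , (λ ())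
thirdDir (suc (suc zero) , suc zero) _ = zero , (λ ()) , (λ ())
thirdDir (zero , zero) i≢k = ⊥-elim (i≢k refl)
thirdDir (suc zero , suc zero) i≢k = ⊥-elim (i≢k refl)
thirdDir (suc (suc zero) , suc (suc zero)) i≢k = ⊥-elim (i≢k refl)

geodesicVia : Vertex → DistinctDirs → AGeodesic
geodesicVia v ((i , k) , i≢k) =
  let j , i≢j , j≢k = thirdDir (i , k) i≢k in geo v i j k i≢j i≢k j≢k

u₃-geodesicVia : ∀ v ik → u₃ (geodesicVia v ik) ≡ antipode v
u₃-geodesicVia (_ ∷ _ ∷ _ ∷ []) ((zero , suc zero) , _) = refl
u₃-geodesicVia (_ ∷ _ ∷ _ ∷ []) ((zero , suc (suc zero)) , _) = refl
u₃-geodesicVia (_ ∷ _ ∷ _ ∷ []) ((suc zero , zero) , _) = refl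
u₃-geodesicVia (_ ∷ _ ∷ _ ∷ []) ((suc zero , suc (suc zero)) , _) = refl
u₃-geodesicVia (_ ∷ _ ∷ _ ∷ []) ((suc (suc zero) , zero) , _) = refl
u₃-geodesicVia (_ ∷ _ ∷ _ ∷ []) ((suc (suc zero) , suc zero) , _) = refl
u₃-geodesicVia _ ((zero , zero) , i≢k) = ⊥-elim (i≢k refl)
u₃-geodesicVia _ ((suc zero , suc zero) , i≢k) = ⊥-elim (i≢k refl)
u₃-geodesicVia _ ((suc (suc zero) , suc (suc zero)) , i≢k) = ⊥-elim (i≢k refl)

changes-red-blue : ∀ κ g → c₀ κ g ≡ red → c₂ κ g ≡ blue → changes κ g ≡ 1
changes-red-blue κ g c₀≡red c₂≡blue = begin
  diff (c₀ κ g) (c₁ κ g) + diff (c₁ κ g) (c₂ κ g) ≡⟨ cong₂ (λ a b → diff a (c₁ κ g) + diff (c₁ κ g) b) c₀≡red c₂≡blue ⟩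
  diff red (c₁ κ g) + diff (c₁ κ g) blue          ≡⟨ diff-red-blue (c₁ κ g) ⟩
  1                                               ∎
  where open ≡-Reasoning

c₂-at-u₃ : ∀ κ g → c₂ κ g ≡ edgeColour κ (u₃ g) (d₂ g)
c₂-at-u₃ κ g = sym (edgeColour-flip κ (u₂ g) (d₂ g))

RedBlueSplit : Colouring → Vertex → Set
RedBlueSplit κ v = ∃₂ λ i k → i ≢ k × edgeColour κ v i ≡ red × edgeColour κ (antipode v) k ≡ blue

redBlueSplit? : ∀ κ v → Dec (RedBlueSplit κ v)
redBlueSplit? κ v = Fin.any? λ i → Fin.any? λ k →
  ¬? (i Fin.≟ k) ×-dec edgeColour κ v i ≟ᶜ red ×-dec edgeColour κ (antipode v) k ≟ᶜ blue

redBlueSplit⇒geodesic : ∀ κ v → RedBlueSplit κ v →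
  Σ AGeodesic λ g → (u₀ g ≡ v) × (u₃ g ≡ antipode v) ×
    (changes κ g ≡ 1) × (c₀ κ g ≡ red) × (c₂ κ g ≡ blue)
redBlueSplit⇒geodesic κ v (i , k , i≢k , red-at-v , blue-at-v′) =
  g , refl , u₃≡v′ , changes-red-blue κ g red-at-v blue-last , red-at-v , blue-last
  where
  g : AGeodesic
  g = geodesicVia v ((i , k) , i≢k)
  u₃≡v′ : u₃ g ≡ antipode v
  u₃≡v′ = u₃-geodesicVia v ((i , k) , i≢k)
  blue-last : c₂ κ g ≡ blue
  blue-last = trans (c₂-at-u₃ κ g) (trans (cong (λ w → edgeColour κ w k) u₃≡v′) blue-at-v′)

representative : Fin 4 → Vertex
representative zero                   = false ∷ false ∷ false ∷ []
representative (suc zero)             = false ∷ false ∷ true  ∷ []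
representative (suc (suc zero))       = false ∷ true  ∷ false ∷ []
representative (suc (suc (suc zero))) = false ∷ true  ∷ true  ∷ []

antipodalClass : Vertex → Fin 4
antipodalClass (false ∷ false ∷ false ∷ []) = zero
antipodalClass (false ∷ false ∷ true  ∷ []) = suc zero
antipodalClass (false ∷ true  ∷ false ∷ []) = suc (suc zero)
antipodalClass (false ∷ true  ∷ true  ∷ []) = suc (suc (suc zero))
antipodalClass (true  ∷ false ∷ false ∷ []) = suc (suc (suc zero))
antipodalClass (true  ∷ false ∷ true  ∷ []) = suc (suc zero)
antipodalClass (true  ∷ true  ∷ false ∷ []) = suc zero
antipodalClass (true  ∷ true  ∷ true  ∷ []) = zero

antipodalClass-representative : ∀ j → antipodalClass (representative j) ≡ j
antipodalClass-representative zero                   = refl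
antipodalClass-representative (suc zero)             = refl
antipodalClass-representative (suc (suc zero))       = refl
antipodalClass-representative (suc (suc (suc zero))) = refl

antipodalClass-antipode : ∀ v → antipodalClass (antipode v) ≡ antipodalClass v
antipodalClass-antipode (false ∷ false ∷ false ∷ []) = refl
antipodalClass-antipode (false ∷ false ∷ true  ∷ []) = refl
antipodalClass-antipode (false ∷ true  ∷ false ∷ []) = refl
antipodalClass-antipode (false ∷ true  ∷ true  ∷ []) = refl
antipodalClass-antipode (true  ∷ false ∷ false ∷ []) = refl
antipodalClass-antipode (true  ∷ false ∷ true  ∷ []) = refl
antipodalClass-antipode (true  ∷ true  ∷ false ∷ []) = refl
antipodalClass-antipode (true  ∷ true  ∷ true  ∷ []) = refl

representative-antipodalClass : ∀ v →
  v ≡ representative (antipodalClass v) ⊎ v ≡ antipode (representative (antipodalClass v))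
representative-antipodalClass (false ∷ false ∷ false ∷ []) = inj₁ refl
representative-antipodalClass (false ∷ false ∷ true  ∷ []) = inj₁ refl
representative-antipodalClass (false ∷ true  ∷ false ∷ []) = inj₁ refl
representative-antipodalClass (false ∷ true  ∷ true  ∷ []) = inj₁ refl
representative-antipodalClass (true  ∷ false ∷ false ∷ []) = inj₂ refl
representative-antipodalClass (true  ∷ false ∷ true  ∷ []) = inj₂ refl
representative-antipodalClass (true  ∷ true  ∷ false ∷ []) = inj₂ refl
representative-antipodalClass (true  ∷ true  ∷ true  ∷ []) = inj₂ refl

EndpointsPartition : (Fin 4 → AGeodesic) → Set
EndpointsPartition gs = (v : Vertex) → Σ (Fin 4) λ j → IsEndpoint v (gs j) ×
  ((k : Fin 4) → IsEndpoint v (gs k) → k ≡ j)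

endpointsPartition : ∀ gs → (∀ j → u₀ (gs j) ≡ representative j) →
  (∀ j → u₃ (gs j) ≡ antipode (representative j)) → EndpointsPartition gs
endpointsPartition gs u₀≡ u₃≡ v = antipodalClass v , endpoint (representative-antipodalClass v) , unique
  where
  endpoint : v ≡ representative (antipodalClass v) ⊎ v ≡ antipode (representative (antipodalClass v)) →
             IsEndpoint v (gs (antipodalClass v))
  endpoint (inj₁ v≡r)  = inj₁ (trans v≡r (sym (u₀≡ _)))
  endpoint (inj₂ v≡r′) = inj₂ (trans v≡r′ (sym (u₃≡ _)))
  unique : (k : Fin 4) → IsEndpoint v (gs k) → k ≡ antipodalClass v
  unique k (inj₁ v≡u₀) = begin
    k                                   ≡⟨ antipodalClass-representative k ⟨
    antipodalClass (representative k)   ≡⟨ cong antipodalClass (trans v≡u₀ (u₀≡ k)) ⟨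
    antipodalClass v                    ∎
    where open ≡-Reasoning
  unique k (inj₂ v≡u₃) = begin
    k                                             ≡⟨ antipodalClass-representative k ⟨
    antipodalClass (representative k)             ≡⟨ antipodalClass-antipode (representative k) ⟨
    antipodalClass (antipode (representative k))  ≡⟨ cong antipodalClass (trans v≡u₃ (u₃≡ k)) ⟨
    antipodalClass v                              ∎
    where open ≡-Reasoning

totalChanges : Colouring → (Fin 4 → AGeodesic) → ℕ
totalChanges κ gs = changes κ (gs zero) + changes κ (gs (suc zero))
  + changes κ (gs (suc (suc zero))) + changes κ (gs (suc (suc (suc zero))))

-- Only a choice: the bound on the total is checked on the chosen geodesics themselves.
cheapestGeodesic : Colouring → Vertex → AGeodesic
cheapestGeodesic κ v = geodesicVia v (argmin (λ ik → changes κ (geodesicVia v ik)) d₀₁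
  (toList (d₀₂ ∷ d₁₀ ∷ d₁₂ ∷ d₂₀ ∷ d₂₁ ∷ [])))
  where
  d₀₁ d₀₂ d₁₀ d₁₂ d₂₀ d₂₁ : DistinctDirs
  d₀₁ = (zero , suc zero) , λ ()
  d₀₂ = (zero , suc (suc zero)) , λ ()
  d₁₀ = (suc zero , zero) , λ ()
  d₁₂ = (suc zero , suc (suc zero)) , λ ()
  d₂₀ = (suc (suc zero) , zero) , λ ()
  d₂₁ = (suc (suc zero) , suc zero) , λ ()

cheapestGeodesics : Colouring → Fin 4 → AGeodesic
cheapestGeodesics κ j = cheapestGeodesic κ (representative j)

good-if-cheap : ∀ κ → totalChanges κ (cheapestGeodesics κ) ≤ 2 → Good κ
good-if-cheap κ cheap = cheapestGeodesics κ ,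
  endpointsPartition (cheapestGeodesics κ) (λ _ → refl) (λ j → u₃-geodesicVia (representative j) _) ,
  cheap

SameEdgeColours : Colouring → Colouring → Set
SameEdgeColours κ κ′ = ∀ v i → edgeColour κ v i ≡ edgeColour κ′ v i

changes-cong : ∀ κ κ′ → SameEdgeColours κ κ′ → ∀ g → changes κ g ≡ changes κ′ g
changes-cong κ κ′ same g =
  cong₂ _+_ (cong₂ diff (same (u₀ g) (d₀ g)) (same (u₁ g) (d₁ g)))
            (cong₂ diff (same (u₁ g) (d₁ g)) (same (u₂ g) (d₂ g)))

Good-cong : ∀ κ κ′ → SameEdgeColours κ κ′ → Good κ → Good κ′
Good-cong κ κ′ same (gs , partition , ≤2) = gs , partition , subst (_≤ 2) same-total ≤2
  where
  same-total : totalChanges κ gs ≡ totalChanges κ′ gs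
  same-total = cong₂ _+_ (cong₂ _+_ (cong₂ _+_ (same-at zero) (same-at (suc zero)))
    (same-at (suc (suc zero)))) (same-at (suc (suc (suc zero))))
    where
    same-at : ∀ j → changes κ (gs j) ≡ changes κ′ (gs j)
    same-at j = changes-cong κ κ′ same (gs j)

RedBlueSplit-cong : ∀ κ κ′ → SameEdgeColours κ κ′ → ∀ v → RedBlueSplit κ v → RedBlueSplit κ′ v
RedBlueSplit-cong κ κ′ same v (i , k , i≢k , red-at-v , blue-at-v′) =
  i , k , i≢k , trans (sym (same v i)) red-at-v , trans (sym (same (antipode v) k)) blue-at-v′

twoBits : Bool → Bool → Fin 4
twoBits false false = zero
twoBits false true  = suc zero
twoBits true  false = suc (suc zero)
twoBits true  true  = suc (suc (suc zero))

highBit lowBit : Fin 4 → Bool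
highBit n = lookup (false ∷ false ∷ true ∷ true ∷ []) n
lowBit  n = lookup (false ∷ true ∷ false ∷ true ∷ []) n

highBit-twoBits : ∀ a b → highBit (twoBits a b) ≡ a
highBit-twoBits false false = refl
highBit-twoBits false true  = refl
highBit-twoBits true  false = refl
highBit-twoBits true  true  = refl

lowBit-twoBits : ∀ a b → lowBit (twoBits a b) ≡ b
lowBit-twoBits false false = refl
lowBit-twoBits false true  = refl
lowBit-twoBits true  false = refl
lowBit-twoBits true  true  = refl

edgeKey : Dir → Vertex → Fin 4
edgeKey zero             (_ ∷ y ∷ z ∷ []) = twoBits y z
edgeKey (suc zero)       (x ∷ _ ∷ z ∷ []) = twoBits x z
edgeKey (suc (suc zero)) (x ∷ y ∷ _ ∷ []) = twoBits x y

edgeBase : Dir → Fin 4 → Vertex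
edgeBase zero             n = false ∷ highBit n ∷ lowBit n ∷ []
edgeBase (suc zero)       n = highBit n ∷ false ∷ lowBit n ∷ []
edgeBase (suc (suc zero)) n = highBit n ∷ lowBit n ∷ false ∷ []

edgeBase-edgeKey : ∀ i v → edgeBase i (edgeKey i v) ≡ v [ i ]≔ false
edgeBase-edgeKey zero (_ ∷ y ∷ z ∷ []) =
  cong₂ (λ a b → false ∷ a ∷ b ∷ []) (highBit-twoBits y z) (lowBit-twoBits y z)
edgeBase-edgeKey (suc zero) (x ∷ _ ∷ z ∷ []) =
  cong₂ (λ a b → a ∷ false ∷ b ∷ []) (highBit-twoBits x z) (lowBit-twoBits x z)
edgeBase-edgeKey (suc (suc zero)) (x ∷ y ∷ _ ∷ []) =
  cong₂ (λ a b → a ∷ b ∷ false ∷ []) (highBit-twoBits x y) (lowBit-twoBits x y)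

fromTable : Vec (Vec Colour 4) 3 → Colouring
fromTable t i v = lookup (lookup t i) (edgeKey i v)

table : Colouring → Vec (Vec Colour 4) 3
table κ = tabulate λ i → tabulate (κ i ∘ edgeBase i)

fromTable-table : ∀ κ → SameEdgeColours (fromTable (table κ)) κ
fromTable-table κ v i = begin
  lookup (lookup (tabulate row) i) (edgeKey i w) ≡⟨ cong (λ r → lookup r (edgeKey i w)) (lookup∘tabulate row i) ⟩
  lookup (row i) (edgeKey i w)                   ≡⟨ lookup∘tabulate (κ i ∘ edgeBase i) (edgeKey i w) ⟩
  κ i (edgeBase i (edgeKey i w))                 ≡⟨ cong (κ i) (edgeBase-edgeKey i w) ⟩
  κ i (w [ i ]≔ false)                           ≡⟨ cong (κ i) (updateAt-updateAt i v) ⟩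
  κ i (v [ i ]≔ false)                           ∎
  where
  open ≡-Reasoning
  row : Dir → Vec Colour 4
  row j = tabulate (κ j ∘ edgeBase j)
  w : Vertex
  w = v [ i ]≔ false

∀-Bool? : {P : Bool → Set} → Decidable P → Dec (∀ b → P b)
∀-Bool? P? = map′ (λ (p-false , p-true) → λ { false → p-false ; true → p-true })
  (λ p → p false , p true) (P? false ×-dec P? true)

∀-Colour? : {P : Colour → Set} → Decidable P → Dec (∀ c → P c)
∀-Colour? P? = map′ (λ (p-red , p-blue) → λ { red → p-red ; blue → p-blue })
  (λ p → p red , p blue) (P? red ×-dec P? blue)

∀-Vec? : {A : Set} → (∀ {P : A → Set} → Decidable P → Dec (∀ a → P a)) →
  ∀ {n} {P : Vec A n → Set} → Decidable P → Dec (∀ xs → P xs)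
∀-Vec? ∀? {ℕ.zero}  P? = map′ (λ p → λ { [] → p }) (λ p → p []) (P? [])
∀-Vec? ∀? {ℕ.suc n} P? = map′ (λ p → λ { (x ∷ xs) → p x xs }) (λ p x xs → p (x ∷ xs))
  (∀? λ x → ∀-Vec? ∀? λ xs → P? (x ∷ xs))

CheapOrSplit : Colouring → Set
CheapOrSplit κ = totalChanges κ (cheapestGeodesics κ) ≤ 2 ⊎ (∀ v → RedBlueSplit κ v)

cheapOrSplit? : ∀ κ → Dec (CheapOrSplit κ)
cheapOrSplit? κ = totalChanges κ (cheapestGeodesics κ) ≤? 2 ⊎-dec ∀-Vec? ∀-Bool? (redBlueSplit? κ)

cheapOrSplit-fromTable : ∀ t → CheapOrSplit (fromTable t)
cheapOrSplit-fromTable = toWitness {a? = ∀-Vec? (∀-Vec? ∀-Colour?) (cheapOrSplit? ∘ fromTable)} _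

-- Eliminating the decided disjunction with `with` or Data.Sum.map instead makes the type
-- checker unfold the cheapest-geodesic computation on an unknown colouring, which is very slow.
cheapOrSplit⇒goodOrSplit : ∀ κ κ′ → SameEdgeColours κ κ′ → CheapOrSplit κ →
  Good κ′ ⊎ (∀ v → RedBlueSplit κ′ v)
cheapOrSplit⇒goodOrSplit κ κ′ same (inj₁ cheap) = inj₁ (Good-cong κ κ′ same (good-if-cheap κ cheap))
cheapOrSplit⇒goodOrSplit κ κ′ same (inj₂ split) = inj₂ λ v → RedBlueSplit-cong κ κ′ same v (split v)

good-or-split : ∀ κ → Good κ ⊎ (∀ v → RedBlueSplit κ v)
good-or-split κ = cheapOrSplit⇒goodOrSplit (fromTable (table κ)) κ (fromTable-table κ)
  (cheapOrSplit-fromTable (table κ))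

lemma8 : (κ : Colouring) → Bad κ → (v : Vertex) →
    Σ AGeodesic λ g → (u₀ g ≡ v) × (u₃ g ≡ antipode v) ×
      (changes κ g ≡ 1) × (c₀ κ g ≡ red) × (c₂ κ g ≡ blue)
lemma8 κ bad v =
  [ ⊥-elim ∘ bad , (λ split → redBlueSplit⇒geodesic κ v (split v)) ]′ (good-or-split κ)
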